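{- Let $(P,w,E)$ be a partitioned poset. Then there exists a partitioned poset $(P',w',E')$ such that $K_{P,E}(\mathbf x)=K_{P',E'}(\mathbf x)$, the poset $P'$ is obtained from $P$ by adding order relations (same ground set), $E'$ is obtained from $E$ by joining equivalence classes, and $E'$ is a chain congruence on $P'$.
   Context: A partitioned poset $(P,w,E)$ is a finite poset $P$ with a natural labeling $w:P\to[n]$ (a bijection with $x<_Py\Rightarrow w(x)<w(y)$) and an equivalence relation $E$ on $P$; $[x]_E$ denotes the class of $x$. $K_{P,E}(\mathbf x)=\sum_f\prod_{x\in P}\mathbf x_{f(x)}$, summed over maps $f:P\to\mathbb N^+$ with $x<_Py\Rightarrow f(x)\le f(y)$ and $f(x)=f(y)$ whenever $x\sim_Ey$. An equivalence relation $E$ on $P$ is a chain congruence if (i) every class $[x]_E$ is a chain in $P$, and (ii) whenever $x<_Py$ and $x\not\sim_Ey$, we have $\max[x]_E<_P\min[y]_E$. -}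

module Defs where

open import Level using (0ℓ)
open import Data.Nat as ℕ using (ℕ)
open import Data.Fin as Fin using (Fin)
open import Data.Fin.Properties using (all?) renaming (_≟_ to _≟F_)
open import Data.Vec as Vec using (Vec; []; _∷_; lookup; count)
open import Data.List as List using (List; length; filter; concatMap)
open import Data.Product using (_×_; ∃-syntax; Σ-syntax)
open import Data.Sum using (_⊎_)
open import Relation.Nullary using (¬_; Dec)
open import Relation.Nullary.Decidable using (_×-dec_; _→-dec_; ¬?)
open import Relation.Binary using (Rel; IsPartialOrder; IsEquivalence; Decidable)
open import Relation.Binary.PropositionalEquality using (_≡_)
open import Function.Definitions using (Bijective)

record PartitionedPoset (n : ℕ) : Set₁ where
  field
    _≤P_           : Rel (Fin n) 0ℓ
    isPartialOrder : IsPartialOrder _≡_ _≤P_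
    _≤P?_          : Decidable _≤P_
    _∼E_           : Rel (Fin n) 0ℓ
    isEquivalence  : IsEquivalence _∼E_
    _∼E?_          : Decidable _∼E_
    -- natural labeling w : P → [n], [n] represented by Fin n
    w              : Fin n → Fin n
    w-bijective    : Bijective _≡_ _≡_ w

  _<P_ : Rel (Fin n) 0ℓ
  x <P y = x ≤P y × ¬ (x ≡ y)

  field
    w-natural      : ∀ x y → x <P y → w x Fin.< w y

  _<P?_ : Decidable _<P_
  x <P? y = (x ≤P? y) ×-dec ¬? (x ≟F y)

open PartitionedPoset public

Compatible : ∀ {n} (P : PartitionedPoset n) {m} → Vec (Fin m) n → Set
Compatible P f =
  (∀ x y → _<P_ P x y → lookup f x Fin.≤ lookup f y) ×
  (∀ x y → _∼E_ P x y → lookup f x ≡ lookup f y)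

compatible? : ∀ {n} (P : PartitionedPoset n) {m} (f : Vec (Fin m) n) → Dec (Compatible P f)
compatible? P f =
  all? (λ x → all? (λ y → _→-dec_ (_<P?_ P x y) (lookup f x Fin.≤? lookup f y))) ×-dec
  all? (λ x → all? (λ y → _→-dec_ (_∼E?_ P x y) (lookup f x ≟F lookup f y)))

-- f has monomial x^α, i.e. |f⁻¹(i)| = α i for every variable index i.
HasMonomial : ∀ {n m} → (Fin m → ℕ) → Vec (Fin m) n → Set
HasMonomial α f = ∀ i → count (_≟F i) f ≡ α i

hasMonomial? : ∀ {n m} (α : Fin m → ℕ) (f : Vec (Fin m) n) → Dec (HasMonomial α f)
hasMonomial? α f = all? (λ i → count (_≟F i) f ℕ.≟ α i)

allMaps : ∀ m n → List (Vec (Fin m) n)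
allMaps m ℕ.zero    = [] List.∷ List.[]
allMaps m (ℕ.suc n) = concatMap (λ v → List.map (_∷ v) (List.allFin m)) (allMaps m n)

-- Coefficient of the monomial x₁^{α 1} ⋯ x_m^{α m} in K_{P,E}(x).
coeffK : ∀ {n} (P : PartitionedPoset n) (m : ℕ) (α : Fin m → ℕ) → ℕ
coeffK {n} P m α =
  length (filter (λ f → compatible? P f ×-dec hasMonomial? α f) (allMaps m n))

-- Equality of the formal power series K_{P,E} and K_{Q,F}: all coefficients agree.
-- Every monomial involves finitely many variables, hence lies among x₁,…,x_m for some m.
_≈K_ : ∀ {n} → PartitionedPoset n → PartitionedPoset n → Set
P ≈K Q = ∀ m (α : Fin m → ℕ) → coeffK P m α ≡ coeffK Q m α

IsMaxOfClass : ∀ {n} (P : PartitionedPoset n) → Fin n → Fin n → Set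
IsMaxOfClass P x a = _∼E_ P a x × (∀ z → _∼E_ P z x → _≤P_ P z a)

IsMinOfClass : ∀ {n} (P : PartitionedPoset n) → Fin n → Fin n → Set
IsMinOfClass P x a = _∼E_ P a x × (∀ z → _∼E_ P z x → _≤P_ P a z)

IsChainCongruence : ∀ {n} → PartitionedPoset n → Set
IsChainCongruence P =
  (∀ x y → _∼E_ P x y → _≤P_ P x y ⊎ _≤P_ P y x) ×
  (∀ x y → _<P_ P x y → ¬ (_∼E_ P x y) →
     ∀ a b → IsMaxOfClass P x a → IsMinOfClass P y b → _<P_ P a b)

module Submission where

-- Write x ≼ y if every (P,E)-compatible 0/1-valued map g satisfies
-- g x ≤ g y; equivalently, every E-saturated up-set of P containing x also
-- contains y.  This is the preorder generated by ≤_P and E, and a threshold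
-- argument shows that EVERY compatible map, whatever its values, is monotone
-- along ≼.  Let E′ be the equivalence induced by ≼ and let ⊑ be ≼ with ties
-- inside an E′-class broken by the labels w.  Then ⊑ extends ≤_P, E′
-- coarsens E, (⊑,E′) has exactly the same compatible maps as (P,E) — so the
-- K-functions agree — and E′ is a chain congruence on ⊑.  A natural labeling
-- of ⊑ is obtained by ranking elements along the injective code (#{z ≼ x}, w x).

open import Defs
open import Level using (0ℓ)
open import Data.Nat as ℕ using (ℕ; zero; suc; s≤s; z≤n)
import Data.Nat.Properties as ℕP
open import Data.Bool using (true)
open import Data.Fin as Fin using (Fin; toℕ; fromℕ<; punchOut; combine)
import Data.Fin.Properties as FP
open import Data.Fin.Subset using (Subset; _∈_; ∣_∣)
import Data.Fin.Subset.Properties as SubP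
open import Data.Vec as Vec using (Vec; []; _∷_; lookup; tabulate)
open import Data.Vec.Properties using (lookup-map; lookup∘tabulate; lookup⇒[]=; []=⇒lookup)
open import Data.List using (length)
open import Data.List.Properties using (filter-≐)
open import Data.Product using (_×_; _,_; proj₁; ∃-syntax)
open import Data.Sum using (_⊎_; inj₁; inj₂)
open import Function using (_∘_)
open import Function.Definitions using (Injective; Surjective; Bijective)
open import Relation.Nullary using (¬_; Dec; yes; no; does; contradiction)
open import Relation.Nullary.Decidable using (map′; _×-dec_; _→-dec_; dec-true; dec-false; decidable-stable)
open import Relation.Unary as U using (Pred)
open import Relation.Binary using (Rel; Decidable; IsPreorder; IsPartialOrder; IsEquivalence; Setoid; tri<; tri≈; tri>)
open import Relation.Binary.PropositionalEquality
  using (_≡_; _≢_; refl; sym; trans; cong; subst; subst₂) renaming (isEquivalence to ≡-isEquivalence)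
import Relation.Binary.Properties.Preorder as PreorderProperties

subset : ∀ {n} {Q : Pred (Fin n) 0ℓ} → U.Decidable Q → Subset n
subset Q? = tabulate (λ x → does (Q? x))

∈-subset⁺ : ∀ {n} {Q : Pred (Fin n) 0ℓ} (Q? : U.Decidable Q) {x} → Q x → x ∈ subset Q?
∈-subset⁺ Q? {x} q =
  lookup⇒[]= x _ (trans (lookup∘tabulate _ x) (dec-true (Q? x) q))

∈-subset⁻ : ∀ {n} {Q : Pred (Fin n) 0ℓ} (Q? : U.Decidable Q) {x} → x ∈ subset Q? → Q x
∈-subset⁻ Q? {x} x∈ = decidable-stable (Q? x) λ ¬Qx →
  contradiction (trans (sym does≡true) (dec-false (Q? x) ¬Qx)) λ ()
  where
  does≡true : does (Q? x) ≡ true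
  does≡true = trans (sym (lookup∘tabulate _ x)) ([]=⇒lookup x∈)

#[_] : ∀ {n} {Q : Pred (Fin n) 0ℓ} → U.Decidable Q → ℕ
#[ Q? ] = ∣ subset Q? ∣

module _ {n} {Q R : Pred (Fin n) 0ℓ} (Q? : U.Decidable Q) (R? : U.Decidable R) where

  #-mono : (∀ {x} → Q x → R x) → #[ Q? ] ℕ.≤ #[ R? ]
  #-mono Q⊆R = SubP.p⊆q⇒∣p∣≤∣q∣ (∈-subset⁺ R? ∘ Q⊆R ∘ ∈-subset⁻ Q?)

  #-strict : (∀ {x} → Q x → R x) → ∀ z → R z → ¬ Q z → #[ Q? ] ℕ.< #[ R? ]
  #-strict Q⊆R z Rz ¬Qz = SubP.p⊂q⇒∣p∣<∣q∣
    ( ∈-subset⁺ R? ∘ Q⊆R ∘ ∈-subset⁻ Q?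
    , z , ∈-subset⁺ R? Rz , ¬Qz ∘ ∈-subset⁻ Q?)

#-<n : ∀ {n} {Q : Pred (Fin n) 0ℓ} (Q? : U.Decidable Q) → ∀ z → ¬ Q z → #[ Q? ] ℕ.< n
#-<n {n} Q? z ¬Qz = subst (#[ Q? ] ℕ.<_) (SubP.∣⊤∣≡n n)
  (SubP.p⊂q⇒∣p∣<∣q∣ (SubP.⊆⊤ , z , SubP.∈⊤ , ¬Qz ∘ ∈-subset⁻ Q?))

injective⇒surjective : ∀ {n} (f : Fin n → Fin n) → Injective _≡_ _≡_ f → Surjective _≡_ _≡_ f
injective⇒surjective {zero} f f-inj ()
injective⇒surjective {suc n} f f-inj y with FP.any? (λ x → f x FP.≟ y)
... | yes (x , fx≡y) = x , λ { refl → fx≡y }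
... | no ¬hit = contradiction (FP.injective⇒≤ g-injective) ℕP.1+n≰n
  where
  -- f misses y, so it factors injectively through Fin n with y punched out
  g : Fin (suc n) → Fin n
  g x = punchOut {i = y} {j = f x} (λ y≡fx → ¬hit (x , sym y≡fx))
  g-injective : Injective _≡_ _≡_ g
  g-injective {a} {b} ga≡gb = f-inj (FP.punchOut-injective {i = y}
    (λ y≡fa → ¬hit (a , sym y≡fa)) (λ y≡fb → ¬hit (b , sym y≡fb)) ga≡gb)

module Ranking {n m : ℕ} (φ : Fin n → Fin m) (φ-injective : Injective _≡_ _≡_ φ) where

  -- rank x = #{z | φ z < φ x}, which is < n because x itself is not counted
  rank : Fin n → Fin n
  rank x = fromℕ< (#-<n (λ z → φ z FP.<? φ x) x (FP.<-irrefl refl))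

  rank-mono : ∀ {x y} → φ x Fin.< φ y → rank x Fin.< rank y
  rank-mono {x} {y} φx<φy = subst₂ ℕ._<_
    (sym (FP.toℕ-fromℕ< _)) (sym (FP.toℕ-fromℕ< _))
    (#-strict (λ z → φ z FP.<? φ x) (λ z → φ z FP.<? φ y)
       (λ φz<φx → FP.<-trans φz<φx φx<φy) x φx<φy (FP.<-irrefl refl))

  rank-injective : Injective _≡_ _≡_ rank
  rank-injective {x} {y} rx≡ry with FP.<-cmp (φ x) (φ y)
  ... | tri< φx<φy _ _ = contradiction rx≡ry (FP.<⇒≢ (rank-mono φx<φy))
  ... | tri≈ _ φx≡φy _ = φ-injective φx≡φy
  ... | tri> _ _ φy<φx = contradiction (sym rx≡ry) (FP.<⇒≢ (rank-mono φy<φx))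

  rank-bijective : Bijective _≡_ _≡_ rank
  rank-bijective = rank-injective , injective⇒surjective rank rank-injective

combine-monoʳ-< : ∀ {m k} (i : Fin m) {j l : Fin k} → j Fin.< l → combine i j Fin.< combine i l
combine-monoʳ-< {k = k} i {j} {l} j<l =
  subst₂ ℕ._<_ (sym (FP.toℕ-combine i j)) (sym (FP.toℕ-combine i l))
    (ℕP.+-monoʳ-< (k ℕ.* toℕ i) j<l)

-- Refining a decidable preorder ≼ on Fin n into a partial order ⊑: elements
-- are compared by ≼, and ties inside a class of the induced equivalence ≈ are
-- broken by an injective label ℓ.
module Refinement {n : ℕ} {_≼_ : Rel (Fin n) 0ℓ} (≼-isPreorder : IsPreorder _≡_ _≼_)
                  (_≼?_ : Decidable _≼_) (ℓ : Fin n → Fin n) (ℓ-injective : Injective _≡_ _≡_ ℓ) where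

  open IsPreorder ≼-isPreorder using () renaming (refl to ≼-refl; trans to ≼-trans)

  _≈_ : Rel (Fin n) 0ℓ
  x ≈ y = x ≼ y × y ≼ x

  ≈-isEquivalence : IsEquivalence _≈_
  ≈-isEquivalence = Setoid.isEquivalence
    (PreorderProperties.InducedEquivalence (record { isPreorder = ≼-isPreorder }))

  _≈?_ : Decidable _≈_
  x ≈? y = (x ≼? y) ×-dec (y ≼? x)

  _⊑_ : Rel (Fin n) 0ℓ
  x ⊑ y = x ≼ y × (y ≼ x → ℓ x Fin.≤ ℓ y)

  _⊑?_ : Decidable _⊑_
  x ⊑? y = (x ≼? y) ×-dec ((y ≼? x) →-dec (ℓ x FP.≤? ℓ y))

  ⊑-isPartialOrder : IsPartialOrder _≡_ _⊑_
  ⊑-isPartialOrder = record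
    { isPreorder = record
      { isEquivalence = ≡-isEquivalence
      ; reflexive     = λ { refl → ≼-refl , λ _ → FP.≤-refl }
      ; trans         = ⊑-trans
      }
    ; antisym = λ (x≼y , tie-xy) (y≼x , tie-yx) →
        ℓ-injective (FP.≤-antisym (tie-xy y≼x) (tie-yx x≼y))
    }
    where
    -- if z ≼ x then x, y, z are all ≈-equivalent, so both ties apply
    ⊑-trans : ∀ {x y z} → x ⊑ y → y ⊑ z → x ⊑ z
    ⊑-trans (x≼y , tie-xy) (y≼z , tie-yz) = ≼-trans x≼y y≼z , λ z≼x →
      FP.≤-trans (tie-xy (≼-trans y≼z z≼x)) (tie-yz (≼-trans z≼x x≼y))

  ≈⇒comparable : ∀ {x y} → x ≈ y → x ⊑ y ⊎ y ⊑ x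
  ≈⇒comparable {x} {y} (x≼y , y≼x) with FP.≤-total (ℓ x) (ℓ y)
  ... | inj₁ ℓx≤ℓy = inj₁ (x≼y , λ _ → ℓx≤ℓy)
  ... | inj₂ ℓy≤ℓx = inj₂ (y≼x , λ _ → ℓy≤ℓx)

  ⊑-between-classes : ∀ {x y a b} → x ⊑ y → ¬ x ≈ y → a ≈ x → b ≈ y → a ⊑ b × a ≢ b
  ⊑-between-classes {x} {y} {a} {b} (x≼y , _) x≉y (a≼x , _) (_ , y≼b) =
    (a≼b , λ b≼a → contradiction b≼a b⋠a) , λ { refl → b⋠a ≼-refl }
    where
    a≼b : a ≼ b
    a≼b = ≼-trans a≼x (≼-trans x≼y y≼b)
    b⋠a : ¬ b ≼ a
    b⋠a b≼a = x≉y (x≼y , ≼-trans y≼b (≼-trans b≼a a≼x))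

  level : Fin n → Fin (suc n)
  level x = fromℕ< (s≤s (SubP.∣p∣≤n (subset (_≼? x))))

  level-< : ∀ {x y} → x ≼ y → ¬ y ≼ x → level x Fin.< level y
  level-< {x} {y} x≼y y⋠x = subst₂ ℕ._<_ (sym (FP.toℕ-fromℕ< _)) (sym (FP.toℕ-fromℕ< _))
    (#-strict (_≼? x) (_≼? y) (λ z≼x → ≼-trans z≼x x≼y) y ≼-refl y⋠x)

  level-≈ : ∀ {x y} → x ≈ y → level x ≡ level y
  level-≈ {x} {y} (x≼y , y≼x) = FP.fromℕ<-cong _ _
    (ℕP.≤-antisym (#-mono (_≼? x) (_≼? y) (λ z≼x → ≼-trans z≼x x≼y))
                  (#-mono (_≼? y) (_≼? x) (λ z≼y → ≼-trans z≼y y≼x))) _ _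

  code : Fin n → Fin (suc n ℕ.* n)
  code x = combine (level x) (ℓ x)

  code-injective : Injective _≡_ _≡_ code
  code-injective {x} {y} e = ℓ-injective (FP.combine-injectiveʳ (level x) (ℓ x) (level y) (ℓ y) e)

  -- along ⊑ either the level increases, or it is equal and the label increases
  code-mono : ∀ {x y} → x ⊑ y → x ≢ y → code x Fin.< code y
  code-mono {x} {y} (x≼y , tie) x≢y with y ≼? x
  ... | no y⋠x = FP.combine-monoˡ-< (ℓ x) (ℓ y) (level-< x≼y y⋠x)
  ... | yes y≼x = subst (λ l → combine l (ℓ x) Fin.< code y) (sym (level-≈ (x≼y , y≼x)))
                    (combine-monoʳ-< (level y) (FP.≤∧≢⇒< (tie y≼x) (x≢y ∘ ℓ-injective)))

  open Ranking code code-injective using (rank; rank-mono; rank-bijective) public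

  rank-natural : ∀ {x y} → x ⊑ y → x ≢ y → rank x Fin.< rank y
  rank-natural x⊑y x≢y = rank-mono (code-mono x⊑y x≢y)

∀-vectors? : ∀ {k} n {Q : Vec (Fin k) n → Set} → (∀ v → Dec (Q v)) → Dec (∀ v → Q v)
∀-vectors? zero    Q? = map′ (λ q → λ { [] → q }) (λ h → h []) (Q? [])
∀-vectors? (suc n) Q? = map′ (λ h → λ { (a ∷ v) → h a v }) (λ h a v → h (a ∷ v))
  (FP.all? (λ a → ∀-vectors? n (λ v → Q? (a ∷ v))))

compatible-map : ∀ {n m k} (P : PartitionedPoset n) {h : Fin m → Fin k} →
  (∀ {u v} → u Fin.≤ v → h u Fin.≤ h v) →
  (f : Vec (Fin m) n) → Compatible P f → Compatible P (Vec.map h f)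
compatible-map P {h} h-mono f (f-mono , f-const) =
  (λ x y x<y → subst₂ Fin._≤_ (sym (lookup-map x h f)) (sym (lookup-map y h f))
                 (h-mono (f-mono x y x<y))) ,
  (λ x y x∼y → trans (lookup-map x h f)
                 (trans (cong h (f-const x y x∼y)) (sym (lookup-map y h f))))

atLeast : ∀ {m} → Fin m → Fin m → Fin 2
atLeast a v with a FP.≤? v
... | yes _ = Fin.suc Fin.zero
... | no  _ = Fin.zero

atLeast-mono : ∀ {m} (a : Fin m) {u v} → u Fin.≤ v → atLeast a u Fin.≤ atLeast a v
atLeast-mono a {u} {v} u≤v with a FP.≤? u | a FP.≤? v
... | yes a≤u | no a≰v = contradiction (FP.≤-trans a≤u u≤v) a≰v
... | yes _   | yes _  = ℕP.≤-refl
... | no _    | _      = z≤n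

atLeast-cut : ∀ {m} (a v : Fin m) → atLeast a a Fin.≤ atLeast a v → a Fin.≤ v
atLeast-cut a v cut≤ with a FP.≤? a | a FP.≤? v
... | no a≰a | _       = contradiction FP.≤-refl a≰a
... | yes _  | yes a≤v = a≤v
... | yes _  | no _    with cut≤
...   | ()

module Closure {n : ℕ} (P : PartitionedPoset n) where

  _≼_ : Rel (Fin n) 0ℓ
  x ≼ y = ∀ (g : Vec (Fin 2) n) → Compatible P g → lookup g x Fin.≤ lookup g y

  _≼?_ : Decidable _≼_
  x ≼? y = ∀-vectors? n (λ g → compatible? P g →-dec (lookup g x FP.≤? lookup g y))

  ≼-isPreorder : IsPreorder _≡_ _≼_
  ≼-isPreorder = record
    { isEquivalence = ≡-isEquivalence
    ; reflexive     = λ { refl _ _ → FP.≤-refl }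
    ; trans         = λ x≼y y≼z g g-compat → FP.≤-trans (x≼y g g-compat) (y≼z g g-compat)
    }

  ≤P⇒≼ : ∀ {x y} → _≤P_ P x y → x ≼ y
  ≤P⇒≼ {x} {y} x≤y g (g-mono , _) with x FP.≟ y
  ... | yes refl = FP.≤-refl
  ... | no x≢y   = g-mono x y (x≤y , x≢y)

  ∼E⇒≼ : ∀ {x y} → _∼E_ P x y → x ≼ y
  ∼E⇒≼ {x} {y} x∼y g (_ , g-const) = FP.≤-reflexive (g-const x y x∼y)

  -- Threshold lemma: every compatible map f is monotone along ≼, because
  -- cutting f at the level f x yields a compatible 0/1 map.
  compatible⇒≼-monotone : ∀ {m} (f : Vec (Fin m) n) → Compatible P f →
                          ∀ {x y} → x ≼ y → lookup f x Fin.≤ lookup f y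
  compatible⇒≼-monotone f f-compat {x} {y} x≼y = atLeast-cut (lookup f x) (lookup f y)
    (subst₂ Fin._≤_ (lookup-map x cut f) (lookup-map y cut f)
      (x≼y (Vec.map cut f) (compatible-map P (atLeast-mono (lookup f x)) f f-compat)))
    where
    cut : Fin _ → Fin 2
    cut = atLeast (lookup f x)

module ChainCongruence {n : ℕ} (P : PartitionedPoset n) where
  open Closure P
  open Refinement ≼-isPreorder _≼?_ (w P) (proj₁ (w-bijective P))

  P′ : PartitionedPoset n
  P′ = record
    { _≤P_           = _⊑_
    ; isPartialOrder = ⊑-isPartialOrder
    ; _≤P?_          = _⊑?_
    ; _∼E_           = _≈_
    ; isEquivalence  = ≈-isEquivalence
    ; _∼E?_          = _≈?_
    ; w              = rank
    ; w-bijective    = rank-bijective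
    ; w-natural      = λ x y (x⊑y , x≢y) → rank-natural x⊑y x≢y
    }

  -- ⊑ extends ≤_P: inside an ≈-class, ≤_P is respected by the natural labeling w
  ≤P⇒⊑ : ∀ x y → _≤P_ P x y → x ⊑ y
  ≤P⇒⊑ x y x≤y = ≤P⇒≼ x≤y , λ _ → w-ordered
    where
    w-ordered : w P x Fin.≤ w P y
    w-ordered with x FP.≟ y
    ... | yes x≡y = FP.≤-reflexive (cong (w P) x≡y)
    ... | no x≢y  = ℕP.<⇒≤ (w-natural P x y (x≤y , x≢y))

  ∼E⇒≈ : ∀ x y → _∼E_ P x y → x ≈ y
  ∼E⇒≈ x y x∼y = ∼E⇒≼ x∼y , ∼E⇒≼ (IsEquivalence.sym (isEquivalence P) x∼y)

  compatible⇒compatible′ : ∀ {m} (f : Vec (Fin m) n) → Compatible P f → Compatible P′ f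
  compatible⇒compatible′ f f-compat =
    (λ x y ((x≼y , _) , _) → monotone x≼y) ,
    (λ x y (x≼y , y≼x) → FP.≤-antisym (monotone x≼y) (monotone y≼x))
    where
    monotone = compatible⇒≼-monotone f f-compat

  compatible′⇒compatible : ∀ {m} (f : Vec (Fin m) n) → Compatible P′ f → Compatible P f
  compatible′⇒compatible f (f-mono , f-const) =
    (λ x y (x≤y , x≢y) → f-mono x y (≤P⇒⊑ x y x≤y , x≢y)) ,
    (λ x y x∼y → f-const x y (∼E⇒≈ x y x∼y))

  same-K : P ≈K P′
  same-K m α = cong length (filter-≐ _ _
    ( (λ {f} (f-compat , f-α) → compatible⇒compatible′ f f-compat , f-α)
    , (λ {f} (f-compat , f-α) → compatible′⇒compatible f f-compat , f-α))
    (allMaps m n))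

  chain-congruence : IsChainCongruence P′
  chain-congruence =
    (λ x y → ≈⇒comparable) ,
    (λ x y (x⊑y , _) x≉y a b (a≈x , _) (b≈y , _) → ⊑-between-classes x⊑y x≉y a≈x b≈y)

lemma6p1 : ∀ {n : ℕ} (P : PartitionedPoset n) →
    ∃[ P′ ] (P ≈K P′) ×
            (∀ (x y : Fin n) → _≤P_ P x y → _≤P_ P′ x y) ×
            (∀ (x y : Fin n) → _∼E_ P x y → _∼E_ P′ x y) ×
            IsChainCongruence P′
lemma6p1 P = P′ , same-K , ≤P⇒⊑ , ∼E⇒≈ , chain-congruence
  where open ChainCongruence P
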